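{- For integers $n\ge 0$ and $k\ge0$, let $J^{ES}_{k,n}$ denote the number of evolutionary stable configurations of length $n$ with exactly $k$ occupied lots (with $J^{ES}_{0,0}=1$, counting the empty configuration). Then, as formal power series, $$\sum_{n\ge0}\sum_{k\ge0} J^{ES}_{k,n}\,x^k y^n=\frac{1+xy+x^2y^2-x^2y^3+x^3y^4-x^3y^5}{1-x^2y^3-x^3y^5}.$$
   Context: A configuration of length $n$ is a string $c_1\cdots c_n\in\{0,1\}^n$; $c_p=1$ means lot $p$ is occupied by a house. A house at position $p$ is blocked if $1<p<n$ and $c_{p-1}=c_{p+1}=1$. A configuration is permissible if no house is blocked; it is maximal if it is permissible and changing any single $0$ to $1$ makes it non-permissible. A maximal configuration is resistant to predators if for every empty lot $p$, after setting $c_p=1$ the new house at $p$ is blocked; it is resistant to altruists if for every empty lot $p$, after setting $c_p=1$ some house at a position other than $p$ is blocked. An evolutionary stable configuration is a maximal configuration resistant to both predators and altruists. -}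

module Defs where

open import Data.Bool using (Bool; true; false; if_then_else_)
open import Data.Bool.Properties using () renaming (_≟_ to _≟ᵇ_)
open import Data.Nat using (ℕ; zero; suc; _+_; _∸_)
open import Data.Nat.Properties using (_≟_)
open import Data.Integer using (ℤ; +_; -_) renaming (_+_ to _+ℤ_; _*_ to _*ℤ_)
open import Data.Fin using (Fin; toℕ)
open import Data.Fin.Properties using (any?; all?) renaming (_≟_ to _≟ᶠ_)
open import Data.Vec using (Vec; []; _∷_; lookup; _[_]≔_; count)
open import Data.List using (List; []; _∷_; map; _++_; filter; length)
open import Data.Product using (Σ; _×_; _,_)
open import Relation.Binary.PropositionalEquality using (_≡_)
open import Relation.Nullary using (¬_; Dec; yes; no)
open import Relation.Nullary.Decidable using (_×-dec_; _→-dec_; ¬?; does)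

-- Configurations of length n: c : Vec Bool n, true = occupied.
-- Lot p (1-based in the paper) is the Fin n index p-1 (0-based).

Config : ℕ → Set
Config n = Vec Bool n

Occ : ∀ {n} → Config n → Fin n → Set
Occ c p = lookup c p ≡ true

Empty : ∀ {n} → Config n → Fin n → Set
Empty c p = lookup c p ≡ false

Blocked : ∀ {n} → Config n → Fin n → Set
Blocked {n} c p =
  Occ c p × Σ (Fin n) λ j → Σ (Fin n) λ l →
    (toℕ j + 1 ≡ toℕ p) × (toℕ p + 1 ≡ toℕ l) × Occ c j × Occ c l

Permissible : ∀ {n} → Config n → Set
Permissible c = ∀ p → ¬ Blocked c p

Maximal : ∀ {n} → Config n → Set
Maximal c = Permissible c × (∀ p → Empty c p → ¬ Permissible (c [ p ]≔ true))

ResistantPredators : ∀ {n} → Config n → Set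
ResistantPredators c = ∀ p → Empty c p → Blocked (c [ p ]≔ true) p

ResistantAltruists : ∀ {n} → Config n → Set
ResistantAltruists {n} c =
  ∀ p → Empty c p → Σ (Fin n) λ q → ¬ (q ≡ p) × Blocked (c [ p ]≔ true) q

EvolStable : ∀ {n} → Config n → Set
EvolStable c = Maximal c × ResistantPredators c × ResistantAltruists c

Occ? : ∀ {n} (c : Config n) p → Dec (Occ c p)
Occ? c p = lookup c p ≟ᵇ true

Empty? : ∀ {n} (c : Config n) p → Dec (Empty c p)
Empty? c p = lookup c p ≟ᵇ false

Blocked? : ∀ {n} (c : Config n) p → Dec (Blocked c p)
Blocked? c p = Occ? c p ×-dec any? λ j → any? λ l →
  (toℕ j + 1 ≟ toℕ p) ×-dec (toℕ p + 1 ≟ toℕ l) ×-dec Occ? c j ×-dec Occ? c l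

Permissible? : ∀ {n} (c : Config n) → Dec (Permissible c)
Permissible? c = all? λ p → ¬? (Blocked? c p)

Maximal? : ∀ {n} (c : Config n) → Dec (Maximal c)
Maximal? c = Permissible? c ×-dec all? λ p →
  Empty? c p →-dec ¬? (Permissible? (c [ p ]≔ true))

ResistantPredators? : ∀ {n} (c : Config n) → Dec (ResistantPredators c)
ResistantPredators? c = all? λ p → Empty? c p →-dec Blocked? (c [ p ]≔ true) p

ResistantAltruists? : ∀ {n} (c : Config n) → Dec (ResistantAltruists c)
ResistantAltruists? c = all? λ p → Empty? c p →-dec
  any? λ q → ¬? (q ≟ᶠ p) ×-dec Blocked? (c [ p ]≔ true) q

EvolStable? : ∀ {n} (c : Config n) → Dec (EvolStable c)
EvolStable? c = Maximal? c ×-dec ResistantPredators? c ×-dec ResistantAltruists? c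

houses : ∀ {n} → Config n → ℕ
houses c = count (λ b → b ≟ᵇ true) c

allConfigs : (n : ℕ) → List (Config n)
allConfigs zero    = [] ∷ []
allConfigs (suc n) = map (true ∷_) (allConfigs n) ++ map (false ∷_) (allConfigs n)

J : ℕ → ℕ → ℕ
J k n = length (filter (λ c → EvolStable? c ×-dec (houses c ≟ k)) (allConfigs n))

-- Formal power series in x, y with integer coefficients:
-- f k n = coefficient of x^k y^n.

FPS : Set
FPS = ℕ → ℕ → ℤ

sumTo : ℕ → (ℕ → ℤ) → ℤ
sumTo zero    f = f 0
sumTo (suc m) f = sumTo m f +ℤ f (suc m)

_⊕_ : FPS → FPS → FPS
(f ⊕ g) k n = f k n +ℤ g k n

_⊖_ : FPS → FPS → FPS
(f ⊖ g) k n = f k n +ℤ (- g k n)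

_⊛_ : FPS → FPS → FPS
(f ⊛ g) k n = sumTo k λ i → sumTo n λ j → f i j *ℤ g (k ∸ i) (n ∸ j)

infixl 6 _⊕_ _⊖_
infixl 7 _⊛_

X^_Y^_ : ℕ → ℕ → FPS
(X^ a Y^ b) k n = if does (k ≟ a) then (if does (n ≟ b) then + 1 else + 0) else + 0

JES : FPS
JES k n = + J k n

numerator : FPS
numerator = X^ 0 Y^ 0 ⊕ X^ 1 Y^ 1 ⊕ X^ 2 Y^ 2 ⊖ X^ 2 Y^ 3 ⊕ X^ 3 Y^ 4 ⊖ X^ 3 Y^ 5

denominator : FPS
denominator = X^ 0 Y^ 0 ⊖ X^ 2 Y^ 3 ⊖ X^ 3 Y^ 5

{-# OPTIONS --safe #-}

-- Evolutionary stability is a local condition: no house is blocked, and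
-- every empty lot p has houses at p − 1 and p + 1 (so a predator settling
-- at p is blocked) and at p − 2 or p + 2 (so the settler blocks one of them).
-- Written as a Boolean test, this makes the following a matter of
-- evaluation: a stable configuration of length n ≥ 6 is the block 110 or
-- 10110 followed by a shorter non-empty stable configuration.  Hence
-- J(k, n) = J(k − 2, n − 3) + J(k − 3, n − 5) for n ≥ 6, which is the
-- denominator, and evaluating the coefficients with n ≤ 5 gives the
-- numerator.

module Submission where

open import Defs

open import Algebra.Properties.AbelianGroup using (xyx⁻¹≈y)
open import Algebra.Properties.CommutativeSemigroup using (interchange)
open import Data.Bool using (Bool; true; false; not; _∧_; _∨_; if_then_else_)
open import Data.Bool.Properties using (∧-conicalˡ; ∧-conicalʳ; ∧-zeroʳ; ∧-identityʳ; ¬-not; not-¬; T-≡)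
open import Data.Empty using (⊥-elim)
open import Data.Fin using (Fin; toℕ; zero; suc)
open import Data.Fin.Properties using (toℕ-injective)
open import Data.Integer using (ℤ; +_; -_; 0ℤ; 1ℤ) renaming (_+_ to _+ℤ_; _*_ to _*ℤ_)
import Data.Integer.Properties as ℤ
open import Data.List using ([]; _∷_; map; _++_; filter; length)
open import Data.List.Properties using (filter-++; length-++)
open import Data.Nat using (ℕ; zero; suc; _+_; _∸_; _≤_; _<_; _≡ᵇ_; z≤n; s≤s; s≤s⁻¹)
open import Data.Nat.Properties
  using ( _≟_; _≤?_; +-comm; +-identityʳ; 1+n≢n; n<1+n; m<n⇒m<1+n; <⇒≢; >⇒≢; ≤-<-trans; ≰⇒>
        ; ≤-refl; m≤n⇒m≤1+n; ≤∧≢⇒<; m∸n≤m; m∸[m∸n]≡n )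
open import Data.Product using (Σ; _×_; _,_; proj₁; proj₂)
open import Data.Sum using (_⊎_; inj₁; inj₂)
open import Data.Vec using ([]; _∷_; lookup; _[_]≔_)
open import Function using (_∘_; _⇔_; mk⇔; Equivalence)
open import Function.Properties.Equivalence using () renaming (trans to ⇔-trans; sym to ⇔-sym)
open import Relation.Binary.PropositionalEquality
  using (_≡_; _≢_; _≗_; refl; sym; trans; cong; cong₂; subst; module ≡-Reasoning)
open import Relation.Nullary using (Dec; yes; no; does; proof)
open import Relation.Nullary.Decidable using (dec-true; dec-false)
open import Relation.Nullary.Reflects using (det; fromEquivalence)
open import Relation.Unary using (Pred; Decidable)

open Equivalence using (to; from)

-- Stability as a local condition

-- Lots beyond either end of the street read as empty, so lot (false ∷ c) i
-- and lot (false ∷ false ∷ c) i are the lots one and two places left of i.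
lot : ∀ {n} → Config n → ℕ → Bool
lot []      _       = false
lot (b ∷ c) zero    = b
lot (b ∷ c) (suc i) = lot c i

lookup≡lot : ∀ {n} (c : Config n) p → lookup c p ≡ lot c (toℕ p)
lookup≡lot (b ∷ c) zero    = refl
lookup≡lot (b ∷ c) (suc p) = lookup≡lot c p

lookup⇒lot : ∀ {n} (c : Config n) p {b} → lookup c p ≡ b → lot c (toℕ p) ≡ b
lookup⇒lot c p = trans (sym (lookup≡lot c p))

lot∘update : ∀ {n} (c : Config n) p b → lot (c [ p ]≔ b) (toℕ p) ≡ b
lot∘update (_ ∷ c) zero    b = refl
lot∘update (_ ∷ c) (suc p) b = lot∘update c p b

lot∘update′ : ∀ {n} (c : Config n) p b {i} → i ≢ toℕ p → lot (c [ p ]≔ b) i ≡ lot c i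
lot∘update′ (_ ∷ c) zero    b {zero}  i≢p = ⊥-elim (i≢p refl)
lot∘update′ (_ ∷ c) zero    b {suc i} _   = refl
lot∘update′ (_ ∷ c) (suc p) b {zero}  _   = refl
lot∘update′ (_ ∷ c) (suc p) b {suc i} i≢p = lot∘update′ c p b (i≢p ∘ cong suc)

occupiedLot : ∀ {n} (c : Config n) {i} → lot c i ≡ true → Σ (Fin n) λ p → toℕ p ≡ i × Occ c p
occupiedLot (b ∷ c) {zero}  occ = zero , refl , occ
occupiedLot (b ∷ c) {suc i} occ with occupiedLot c occ
... | p , refl , occ′ = suc p , refl , occ′

occupiedLeftLot : ∀ {n} (c : Config n) {i} → lot (false ∷ c) i ≡ true →
  Σ (Fin n) λ p → suc (toℕ p) ≡ i × Occ c p
occupiedLeftLot c {zero}  ()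
occupiedLeftLot c {suc i} occ with occupiedLot c occ
... | p , refl , occ′ = p , refl , occ′

blockedᵇ : ∀ {n} → Config n → ℕ → Bool
blockedᵇ c i = lot (false ∷ c) i ∧ lot c i ∧ lot c (suc i)

Blocked⇒blockedᵇ : ∀ {n} (c : Config n) p → Blocked c p → blockedᵇ c (toℕ p) ≡ true
Blocked⇒blockedᵇ c p (occ , j , l , j+1≡p , p+1≡l , occʲ , occˡ) =
  cong₂ _∧_ left (cong₂ _∧_ (lookup⇒lot c p occ) right)
  where
  left : lot (false ∷ c) (toℕ p) ≡ true
  left = subst (λ i → lot (false ∷ c) i ≡ true) (trans (+-comm 1 (toℕ j)) j+1≡p) (lookup⇒lot c j occʲ)
  right : lot c (suc (toℕ p)) ≡ true
  right = subst (λ i → lot c i ≡ true) (sym (trans (+-comm 1 (toℕ p)) p+1≡l)) (lookup⇒lot c l occˡ)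

blockedᵇ-lots : ∀ {n} (c : Config n) {i} → blockedᵇ c i ≡ true →
  lot (false ∷ c) i ≡ true × lot c i ≡ true × lot c (suc i) ≡ true
blockedᵇ-lots c {i} blk with lot (false ∷ c) i | lot c i | lot c (suc i)
blockedᵇ-lots c refl | true | true | true = refl , refl , refl

blockedᵇ⇒Blocked : ∀ {n} (c : Config n) p → blockedᵇ c (toℕ p) ≡ true → Blocked c p
blockedᵇ⇒Blocked c p blk with blockedᵇ-lots c blk
... | left , centre , right with occupiedLeftLot c left | occupiedLot c right
... | j , 1+j≡p , occʲ | l , l≡1+p , occˡ =
  trans (lookup≡lot c p) centre , j , l ,
  trans (+-comm (toℕ j) 1) 1+j≡p , trans (+-comm (toℕ p) 1) (sym l≡1+p) , occʲ , occˡ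

blockedHouse : ∀ {n} (c : Config n) {i} → blockedᵇ c i ≡ true → Σ (Fin n) λ q → toℕ q ≡ i × Blocked c q
blockedHouse c {i} blk with occupiedLot c {i} (proj₁ (proj₂ (blockedᵇ-lots c blk)))
... | q , refl , _ = q , refl , blockedᵇ⇒Blocked c q blk

blockedLeftHouse : ∀ {n} (c : Config n) {i} → blockedᵇ (false ∷ c) i ≡ true →
  Σ (Fin n) λ q → suc (toℕ q) ≡ i × Blocked c q
blockedLeftHouse c {zero}  ()
blockedLeftHouse c {suc i} blk with blockedHouse c {i} blk
... | q , refl , blocked = q , refl , blocked

∨≡true⇔ : ∀ a b → a ∨ b ≡ true ⇔ (a ≡ true ⊎ b ≡ true)
∨≡true⇔ true  b = mk⇔ (λ _ → inj₁ refl) (λ _ → refl)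
∨≡true⇔ false b = mk⇔ inj₂ λ { (inj₁ ()) ; (inj₂ h) → h }

settlerBlockedᵇ : ∀ {n} → Config n → ℕ → Bool
settlerBlockedᵇ c i = lot (false ∷ c) i ∧ lot c (suc i)

settlerBlocksᵇ : ∀ {n} → Config n → ℕ → Bool
settlerBlocksᵇ c i =
  (lot (false ∷ false ∷ c) i ∧ lot (false ∷ c) i) ∨ (lot c (suc i) ∧ lot c (suc (suc i)))

module _ {n} (c : Config n) (p : Fin n) where

  private
    c′ : Config n
    c′ = c [ p ]≔ true

    P : ℕ
    P = toℕ p

    settled : lot c′ P ≡ true
    settled = lot∘update c p true

    unchanged : ∀ {i} → i ≢ P → lot c′ i ≡ lot c i
    unchanged = lot∘update′ c p true

    unchanged₁ : ∀ {i} → i ≢ suc P → lot (false ∷ c′) i ≡ lot (false ∷ c) i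
    unchanged₁ = lot∘update′ (false ∷ c) (suc p) true

    unchanged₂ : ∀ {i} → i ≢ suc (suc P) → lot (false ∷ false ∷ c′) i ≡ lot (false ∷ false ∷ c) i
    unchanged₂ = lot∘update′ (false ∷ false ∷ c) (suc (suc p)) true

    P<2+P : P < suc (suc P)
    P<2+P = m<n⇒m<1+n (n<1+n P)

  blockedᵇ-settler : blockedᵇ c′ P ≡ settlerBlockedᵇ c P
  blockedᵇ-settler = begin
      lot (false ∷ c′) P ∧ lot c′ P ∧ lot c′ (suc P)
    ≡⟨ cong (λ b → lot (false ∷ c′) P ∧ b ∧ lot c′ (suc P)) settled ⟩
      lot (false ∷ c′) P ∧ lot c′ (suc P)
    ≡⟨ cong₂ _∧_ (unchanged₁ (<⇒≢ (n<1+n P))) (unchanged 1+n≢n) ⟩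
      settlerBlockedᵇ c P
    ∎
    where open ≡-Reasoning

  blockedᵇ-settler-right : blockedᵇ c′ (suc P) ≡ lot c (suc P) ∧ lot c (suc (suc P))
  blockedᵇ-settler-right = begin
      lot c′ P ∧ lot c′ (suc P) ∧ lot c′ (suc (suc P))
    ≡⟨ cong (λ b → b ∧ lot c′ (suc P) ∧ lot c′ (suc (suc P))) settled ⟩
      lot c′ (suc P) ∧ lot c′ (suc (suc P))
    ≡⟨ cong₂ _∧_ (unchanged 1+n≢n) (unchanged (>⇒≢ P<2+P)) ⟩
      lot c (suc P) ∧ lot c (suc (suc P))
    ∎
    where open ≡-Reasoning

  blockedᵇ-settler-left : blockedᵇ (false ∷ c′) P ≡ lot (false ∷ false ∷ c) P ∧ lot (false ∷ c) P
  blockedᵇ-settler-left = begin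
      lot (false ∷ false ∷ c′) P ∧ lot (false ∷ c′) P ∧ lot c′ P
    ≡⟨ cong (λ b → lot (false ∷ false ∷ c′) P ∧ lot (false ∷ c′) P ∧ b) settled ⟩
      lot (false ∷ false ∷ c′) P ∧ lot (false ∷ c′) P ∧ true
    ≡⟨ cong (lot (false ∷ false ∷ c′) P ∧_) (∧-identityʳ _) ⟩
      lot (false ∷ false ∷ c′) P ∧ lot (false ∷ c′) P
    ≡⟨ cong₂ _∧_ (unchanged₂ (<⇒≢ P<2+P)) (unchanged₁ (<⇒≢ (n<1+n P))) ⟩
      lot (false ∷ false ∷ c) P ∧ lot (false ∷ c) P
    ∎
    where open ≡-Reasoning

  blockedᵇ-settler-far : ∀ {i} → i ≢ P → suc i ≢ P → i ≢ suc P → blockedᵇ c′ i ≡ blockedᵇ c i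
  blockedᵇ-settler-far i≢P 1+i≢P i≢1+P =
    cong₂ _∧_ (unchanged₁ i≢1+P) (cong₂ _∧_ (unchanged i≢P) (unchanged 1+i≢P))

  settlerBlocksᵇ⇔ :
    settlerBlocksᵇ c P ≡ true ⇔ (blockedᵇ (false ∷ c′) P ≡ true ⊎ blockedᵇ c′ (suc P) ≡ true)
  settlerBlocksᵇ⇔ =
    subst (λ b → b ≡ true ⇔ (blockedᵇ (false ∷ c′) P ≡ true ⊎ blockedᵇ c′ (suc P) ≡ true))
          (cong₂ _∨_ blockedᵇ-settler-left blockedᵇ-settler-right)
          (∨≡true⇔ (blockedᵇ (false ∷ c′) P) (blockedᵇ c′ (suc P)))

resistantPredators⇔ : ∀ {n} (c : Config n) →
  ResistantPredators c ⇔ (∀ p → Empty c p → settlerBlockedᵇ c (toℕ p) ≡ true)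
resistantPredators⇔ c = mk⇔
  (λ rp p empty → trans (sym (blockedᵇ-settler c p)) (Blocked⇒blockedᵇ _ p (rp p empty)))
  (λ h p empty → blockedᵇ⇒Blocked _ p (trans (blockedᵇ-settler c p) (h p empty)))

-- Settling at p changes only the neighbourhoods of p − 1, p and p + 1, and c had no blocked house.
blocked-after-settling⇒neighbour : ∀ {n} (c : Config n) p q → Permissible c → q ≢ p →
  blockedᵇ (c [ p ]≔ true) (toℕ q) ≡ true →
  blockedᵇ (false ∷ (c [ p ]≔ true)) (toℕ p) ≡ true ⊎ blockedᵇ (c [ p ]≔ true) (suc (toℕ p)) ≡ true
blocked-after-settling⇒neighbour c p q perm q≢p blk with suc (toℕ q) ≟ toℕ p | toℕ q ≟ suc (toℕ p)
... | yes 1+q≡p | _        = inj₁ (subst (λ i → blockedᵇ (false ∷ (c [ p ]≔ true)) i ≡ true) 1+q≡p blk)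
... | no _      | yes q≡1+p = inj₂ (subst (λ i → blockedᵇ (c [ p ]≔ true) i ≡ true) q≡1+p blk)
... | no 1+q≢p  | no q≢1+p  =
  ⊥-elim (perm q (blockedᵇ⇒Blocked c q
    (trans (sym (blockedᵇ-settler-far c p (q≢p ∘ toℕ-injective) 1+q≢p q≢1+p)) blk)))

resistantAltruists⇔ : ∀ {n} (c : Config n) → Permissible c →
  ResistantAltruists c ⇔ (∀ p → Empty c p → settlerBlocksᵇ c (toℕ p) ≡ true)
resistantAltruists⇔ c perm = mk⇔ altruists⇒ ⇒altruists
  where
  altruists⇒ : ResistantAltruists c → ∀ p → Empty c p → settlerBlocksᵇ c (toℕ p) ≡ true
  altruists⇒ ra p empty with ra p empty
  ... | q , q≢p , blocked =
    from (settlerBlocksᵇ⇔ c p)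
         (blocked-after-settling⇒neighbour c p q perm q≢p (Blocked⇒blockedᵇ (c [ p ]≔ true) q blocked))

  ⇒altruists : (∀ p → Empty c p → settlerBlocksᵇ c (toℕ p) ≡ true) → ResistantAltruists c
  ⇒altruists h p empty with to (settlerBlocksᵇ⇔ c p) (h p empty)
  ... | inj₁ left with blockedLeftHouse (c [ p ]≔ true) left
  ...   | q , 1+q≡p , blocked = q , (λ q≡p → 1+n≢n (trans 1+q≡p (cong toℕ (sym q≡p)))) , blocked
  ⇒altruists h p empty | inj₂ right with blockedHouse (c [ p ]≔ true) right
  ...   | q , q≡1+p , blocked = q , (λ q≡p → 1+n≢n (sym (trans (cong toℕ (sym q≡p)) q≡1+p))) , blocked

stableAtᵇ : ∀ {n} → Config n → ℕ → Bool
stableAtᵇ c i = not (blockedᵇ c i) ∧ (lot c i ∨ settlerBlockedᵇ c i ∧ settlerBlocksᵇ c i)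

allBelowᵇ : ℕ → (ℕ → Bool) → Bool
allBelowᵇ zero    f = true
allBelowᵇ (suc n) f = f zero ∧ allBelowᵇ n (f ∘ suc)

evolStableᵇ : ∀ {n} → Config n → Bool
evolStableᵇ {n} c = allBelowᵇ n (stableAtᵇ c)

not∧∨≡true⇔ : ∀ a b c → not a ∧ (b ∨ c) ≡ true ⇔ (a ≡ false × (b ≡ false → c ≡ true))
not∧∨≡true⇔ true  b     c = mk⇔ (λ ()) (λ { (() , _) })
not∧∨≡true⇔ false true  c = mk⇔ (λ _ → refl , λ ()) (λ _ → refl)
not∧∨≡true⇔ false false c = mk⇔ (λ h → refl , λ _ → h) (λ (_ , h) → h refl)

allBelowᵇ⇔ : ∀ n f → allBelowᵇ n f ≡ true ⇔ (∀ (p : Fin n) → f (toℕ p) ≡ true)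
allBelowᵇ⇔ zero    f = mk⇔ (λ _ ()) (λ _ → refl)
allBelowᵇ⇔ (suc n) f = mk⇔
  (λ { h zero → ∧-conicalˡ _ _ h ; h (suc p) → to (allBelowᵇ⇔ n (f ∘ suc)) (∧-conicalʳ _ _ h) p })
  (λ h → cong₂ _∧_ (h zero) (from (allBelowᵇ⇔ n (f ∘ suc)) (h ∘ suc)))

EvolStable⇔stableAtᵇ : ∀ {n} (c : Config n) → EvolStable c ⇔ (∀ p → stableAtᵇ c (toℕ p) ≡ true)
EvolStable⇔stableAtᵇ c = mk⇔ ES⇒ ⇒ES
  where
  local⇔ : ∀ p → stableAtᵇ c (toℕ p) ≡ true ⇔
    (blockedᵇ c (toℕ p) ≡ false ×
     (lot c (toℕ p) ≡ false → settlerBlockedᵇ c (toℕ p) ∧ settlerBlocksᵇ c (toℕ p) ≡ true))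
  local⇔ p =
    not∧∨≡true⇔ (blockedᵇ c (toℕ p)) (lot c (toℕ p)) (settlerBlockedᵇ c (toℕ p) ∧ settlerBlocksᵇ c (toℕ p))

  ES⇒ : EvolStable c → ∀ p → stableAtᵇ c (toℕ p) ≡ true
  ES⇒ ((perm , _) , rp , ra) p = from (local⇔ p)
    ( ¬-not (perm p ∘ blockedᵇ⇒Blocked c p)
    , λ empty → let empty′ = trans (lookup≡lot c p) empty in
        cong₂ _∧_ (to (resistantPredators⇔ c) rp p empty′) (to (resistantAltruists⇔ c perm) ra p empty′))

  ⇒ES : (∀ p → stableAtᵇ c (toℕ p) ≡ true) → EvolStable c
  ⇒ES h = (perm , λ p empty perm′ → perm′ p (rp p empty)) , rp , ra
    where
    perm : Permissible c
    perm p blocked = not-¬ (proj₁ (to (local⇔ p) (h p))) (Blocked⇒blockedᵇ c p blocked)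
    settles : ∀ p → Empty c p → settlerBlockedᵇ c (toℕ p) ∧ settlerBlocksᵇ c (toℕ p) ≡ true
    settles p empty = proj₂ (to (local⇔ p) (h p)) (lookup⇒lot c p empty)
    rp : ResistantPredators c
    rp = from (resistantPredators⇔ c) λ p empty → ∧-conicalˡ _ _ (settles p empty)
    ra : ResistantAltruists c
    ra = from (resistantAltruists⇔ c perm) λ p empty →
      ∧-conicalʳ (settlerBlockedᵇ c (toℕ p)) _ (settles p empty)

EvolStable⇔evolStableᵇ : ∀ {n} (c : Config n) → EvolStable c ⇔ evolStableᵇ c ≡ true
EvolStable⇔evolStableᵇ {n} c = ⇔-trans (EvolStable⇔stableAtᵇ c) (⇔-sym (allBelowᵇ⇔ n (stableAtᵇ c)))

does-EvolStable? : ∀ {n} (c : Config n) → does (EvolStable? c) ≡ evolStableᵇ c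
does-EvolStable? c = det (proof (EvolStable? c)) (fromEquivalence (from E ∘ to T-≡) (from T-≡ ∘ to E))
  where
  E : EvolStable c ⇔ evolStableᵇ c ≡ true
  E = EvolStable⇔evolStableᵇ c

evolStableᵇ-110 : ∀ {n} (r : Config (suc n)) → evolStableᵇ (true ∷ true ∷ false ∷ r) ≡ evolStableᵇ r
evolStableᵇ-110 (true  ∷ r) = refl
evolStableᵇ-110 (false ∷ r) = refl

evolStableᵇ-10110 : ∀ {n} (r : Config (suc n)) →
  evolStableᵇ (true ∷ false ∷ true ∷ true ∷ false ∷ r) ≡ evolStableᵇ r
evolStableᵇ-10110 (true  ∷ r) = refl
evolStableᵇ-10110 (false ∷ r) = refl

-- Counting configurations

countConfigs : ∀ {n} → (Config n → Bool) → ℕ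
countConfigs {zero}  f = if f [] then 1 else 0
countConfigs {suc n} f = countConfigs (f ∘ (true ∷_)) + countConfigs (f ∘ (false ∷_))

countConfigs-cong : ∀ {n} {f g : Config n → Bool} → f ≗ g → countConfigs f ≡ countConfigs g
countConfigs-cong {zero}  f≗g rewrite f≗g [] = refl
countConfigs-cong {suc n} f≗g =
  cong₂ _+_ (countConfigs-cong (f≗g ∘ (true ∷_))) (countConfigs-cong (f≗g ∘ (false ∷_)))

countConfigs-none : ∀ n → countConfigs {n} (λ _ → false) ≡ 0
countConfigs-none zero    = refl
countConfigs-none (suc n) = cong₂ _+_ (countConfigs-none n) (countConfigs-none n)

length-filter-map : ∀ {a b ℓ} {A : Set a} {B : Set b} {P : Pred B ℓ} (P? : Decidable P) (f : A → B) xs →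
  length (filter P? (map f xs)) ≡ length (filter (P? ∘ f) xs)
length-filter-map P? f []       = refl
length-filter-map P? f (x ∷ xs) with does (P? (f x))
... | true  = cong suc (length-filter-map P? f xs)
... | false = length-filter-map P? f xs

length-filter-allConfigs : ∀ {ℓ} n {P : Pred (Config n) ℓ} (P? : Decidable P) →
  length (filter P? (allConfigs n)) ≡ countConfigs (does ∘ P?)
length-filter-allConfigs zero    P? with does (P? [])
... | true  = refl
... | false = refl
length-filter-allConfigs (suc n) P? = begin
  length (filter P? (map (true ∷_) (allConfigs n) ++ map (false ∷_) (allConfigs n)))
    ≡⟨ cong length (filter-++ P? (map (true ∷_) (allConfigs n)) _) ⟩
  length (filter P? (map (true ∷_) (allConfigs n)) ++ filter P? (map (false ∷_) (allConfigs n)))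
    ≡⟨ length-++ (filter P? (map (true ∷_) (allConfigs n))) ⟩
  length (filter P? (map (true ∷_) (allConfigs n))) + length (filter P? (map (false ∷_) (allConfigs n)))
    ≡⟨ cong₂ _+_ (length-filter-map P? (true ∷_) (allConfigs n)) (length-filter-map P? (false ∷_) (allConfigs n)) ⟩
  length (filter (P? ∘ (true ∷_)) (allConfigs n)) + length (filter (P? ∘ (false ∷_)) (allConfigs n))
    ≡⟨ cong₂ _+_ (length-filter-allConfigs n (P? ∘ (true ∷_))) (length-filter-allConfigs n (P? ∘ (false ∷_))) ⟩
  countConfigs (does ∘ P?) ∎
  where open ≡-Reasoning

stableCount : ℕ → ℕ → ℕ → ℕ
stableCount a k n = countConfigs {n} λ c → evolStableᵇ c ∧ (a + houses c ≡ᵇ k)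

J≡stableCount : ∀ k n → J k n ≡ stableCount 0 k n
J≡stableCount k n = trans (length-filter-allConfigs n _)
  (countConfigs-cong {n} λ c → cong (_∧ (houses c ≡ᵇ k)) (does-EvolStable? c))

-- countConfigs unfolds along the first lots; every branch except the
-- prefixes 110 and 10110 is unstable by evaluation.
stableCount-rec : ∀ k m → stableCount 0 k (6 + m) ≡ stableCount 2 k (3 + m) + stableCount 3 k (1 + m)
stableCount-rec k m = begin
    stableCount 0 k (6 + m)
  ≡⟨ cong₂ _+_ (cong₂ _+_ (cong₂ _+_ (countConfigs-none (3 + m)) after-110)
                          (cong₂ _+_ (cong₂ _+_ (cong₂ _+_ (countConfigs-none (1 + m)) after-10110)
                                                (countConfigs-none (2 + m)))
                                     (countConfigs-none (3 + m))))
               (countConfigs-none (5 + m)) ⟩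
    (stableCount 2 k (3 + m) + ((stableCount 3 k (1 + m) + 0) + 0)) + 0
  ≡⟨ trans (+-identityʳ _) (cong (_+_ (stableCount 2 k (3 + m))) (trans (+-identityʳ _) (+-identityʳ _))) ⟩
    stableCount 2 k (3 + m) + stableCount 3 k (1 + m)
  ∎
  where
  open ≡-Reasoning
  after-110 : countConfigs {3 + m} (λ r → evolStableᵇ (true ∷ true ∷ false ∷ r) ∧ (2 + houses r ≡ᵇ k))
            ≡ stableCount 2 k (3 + m)
  after-110 = countConfigs-cong {3 + m} λ r → cong (_∧ (2 + houses r ≡ᵇ k)) (evolStableᵇ-110 r)
  after-10110 : countConfigs {1 + m} (λ r → evolStableᵇ (true ∷ false ∷ true ∷ true ∷ false ∷ r) ∧ (3 + houses r ≡ᵇ k))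
              ≡ stableCount 3 k (1 + m)
  after-10110 = countConfigs-cong {1 + m} λ r → cong (_∧ (3 + houses r ≡ᵇ k)) (evolStableᵇ-10110 r)

-- Power series

shift : ℕ → ℕ → FPS → FPS
shift a       (suc b) f k       zero    = 0ℤ
shift a       (suc b) f k       (suc n) = shift a b f k n
shift zero    zero    f k       n       = f k n
shift (suc a) zero    f zero    n       = 0ℤ
shift (suc a) zero    f (suc k) n       = shift a zero f k n

shift-≤ : ∀ {a b k n} (f : FPS) → a ≤ k → b ≤ n → shift a b f k n ≡ f (k ∸ a) (n ∸ b)
shift-≤ {a}     {suc b} {n = suc n} f a≤k       (s≤s b≤n) = shift-≤ f a≤k b≤n
shift-≤ {zero}  {zero}              f z≤n       z≤n       = refl
shift-≤ {suc a} {zero}  {suc k}     f (s≤s a≤k) z≤n       = shift-≤ f a≤k z≤n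

shift-<ˣ : ∀ {a k} b n (f : FPS) → k < a → shift a b f k n ≡ 0ℤ
shift-<ˣ                 (suc b) zero    f _         = refl
shift-<ˣ                 (suc b) (suc n) f k<a       = shift-<ˣ b n f k<a
shift-<ˣ {suc a} {zero}  zero    n       f _         = refl
shift-<ˣ {suc a} {suc k} zero    n       f (s≤s k<a) = shift-<ˣ zero n f k<a

shift-<ʸ : ∀ {b n} a k (f : FPS) → n < b → shift a b f k n ≡ 0ℤ
shift-<ʸ {suc b} {zero}  a k f _         = refl
shift-<ʸ {suc b} {suc n} a k f (s≤s n<b) = shift-<ʸ a k f n<b

sumTo-cong : ∀ m {F G : ℕ → ℤ} → (∀ i → i ≤ m → F i ≡ G i) → sumTo m F ≡ sumTo m G
sumTo-cong zero    F≗G = F≗G 0 z≤n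
sumTo-cong (suc m) F≗G = cong₂ _+ℤ_ (sumTo-cong m (λ i i≤m → F≗G i (m≤n⇒m≤1+n i≤m))) (F≗G (suc m) ≤-refl)

sumTo-+ : ∀ m (F G : ℕ → ℤ) → sumTo m (λ i → F i +ℤ G i) ≡ sumTo m F +ℤ sumTo m G
sumTo-+ zero    F G = refl
sumTo-+ (suc m) F G = trans (cong (_+ℤ (F (suc m) +ℤ G (suc m))) (sumTo-+ m F G))
                            (interchange ℤ.+-commutativeSemigroup (sumTo m F) (sumTo m G) (F (suc m)) (G (suc m)))

sumTo-neg : ∀ m (F : ℕ → ℤ) → sumTo m (λ i → - F i) ≡ - sumTo m F
sumTo-neg zero    F = refl
sumTo-neg (suc m) F =
  trans (cong (_+ℤ - F (suc m)) (sumTo-neg m F)) (sym (ℤ.neg-distrib-+ (sumTo m F) (F (suc m))))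

sumTo-zero : ∀ m {F : ℕ → ℤ} → (∀ i → i ≤ m → F i ≡ 0ℤ) → sumTo m F ≡ 0ℤ
sumTo-zero zero    F≡0 = F≡0 0 z≤n
sumTo-zero (suc m) F≡0 = cong₂ _+ℤ_ (sumTo-zero m (λ i i≤m → F≡0 i (m≤n⇒m≤1+n i≤m))) (F≡0 (suc m) ≤-refl)

sumTo-single : ∀ m {t} {F : ℕ → ℤ} → t ≤ m → (∀ i → i ≤ m → i ≢ t → F i ≡ 0ℤ) → sumTo m F ≡ F t
sumTo-single zero    z≤n F≡0 = refl
sumTo-single (suc m) {t} {F} t≤1+m F≡0 with t ≟ suc m
... | yes refl = trans
  (cong (_+ℤ F (suc m)) (sumTo-zero m λ i i≤m → F≡0 i (m≤n⇒m≤1+n i≤m) (<⇒≢ (s≤s i≤m))))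
  (ℤ.+-identityˡ (F (suc m)))
... | no t≢1+m = trans
  (cong₂ _+ℤ_ (sumTo-single m (s≤s⁻¹ (≤∧≢⇒< t≤1+m t≢1+m)) λ i i≤m → F≡0 i (m≤n⇒m≤1+n i≤m))
              (F≡0 (suc m) ≤-refl (t≢1+m ∘ sym)))
  (ℤ.+-identityʳ (F t))

sumTo-sub : ∀ m (F G : ℕ → ℤ) → sumTo m (λ i → F i +ℤ - G i) ≡ sumTo m F +ℤ - sumTo m G
sumTo-sub m F G = trans (sumTo-+ m F (λ i → - G i)) (cong (sumTo m F +ℤ_) (sumTo-neg m G))

i≢k∸a⇒k∸i≢a : ∀ {i k a} → i ≤ k → i ≢ k ∸ a → k ∸ i ≢ a
i≢k∸a⇒k∸i≢a i≤k i≢k∸a refl = i≢k∸a (sym (m∸[m∸n]≡n i≤k))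

X^Y^-diag : ∀ a b → (X^ a Y^ b) a b ≡ 1ℤ
X^Y^-diag a b rewrite dec-true (a ≟ a) refl | dec-true (b ≟ b) refl = refl

X^Y^-offˣ : ∀ {a b k} n → k ≢ a → (X^ a Y^ b) k n ≡ 0ℤ
X^Y^-offˣ {a} {b} {k} n k≢a rewrite dec-false (k ≟ a) k≢a = refl

X^Y^-offʸ : ∀ {a b} k {n} → n ≢ b → (X^ a Y^ b) k n ≡ 0ℤ
X^Y^-offʸ {a} {b} k {n} n≢b rewrite dec-false (n ≟ b) n≢b with does (k ≟ a)
... | true  = refl
... | false = refl

⊛-congˡ : ∀ {f g : FPS} h → (∀ k n → f k n ≡ g k n) → ∀ k n → (f ⊛ h) k n ≡ (g ⊛ h) k n
⊛-congˡ h f≗g k n = sumTo-cong k λ i _ → sumTo-cong n λ j _ → cong (_*ℤ h (k ∸ i) (n ∸ j)) (f≗g i j)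

⊛-⊖ : ∀ f g h k n → (f ⊛ (g ⊖ h)) k n ≡ (f ⊛ g) k n +ℤ - (f ⊛ h) k n
⊛-⊖ f g h k n =
  trans (sumTo-cong k λ i _ → trans (sumTo-cong n λ j _ → distrib (f i j) _ _) (sumTo-sub n _ _)) (sumTo-sub k _ _)
  where
  distrib : ∀ x y z → x *ℤ (y +ℤ - z) ≡ x *ℤ y +ℤ - (x *ℤ z)
  distrib x y z = trans (ℤ.*-distribˡ-+ x y (- z)) (cong (x *ℤ y +ℤ_) (sym (ℤ.neg-distribʳ-* x z)))

⊛-X^Y^ : ∀ f a b k n → (f ⊛ X^ a Y^ b) k n ≡ shift a b f k n
⊛-X^Y^ f a b k n = by-cases (a ≤? k) (b ≤? n)
  where
  open ≡-Reasoning
  term-zero : ∀ i j → (X^ a Y^ b) (k ∸ i) (n ∸ j) ≡ 0ℤ → f i j *ℤ (X^ a Y^ b) (k ∸ i) (n ∸ j) ≡ 0ℤ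
  term-zero i j X≡0 = trans (cong (f i j *ℤ_) X≡0) (ℤ.*-zeroʳ (f i j))

  by-cases : Dec (a ≤ k) → Dec (b ≤ n) → (f ⊛ X^ a Y^ b) k n ≡ shift a b f k n
  by-cases (yes a≤k) (yes b≤n) = begin
      (f ⊛ X^ a Y^ b) k n
    ≡⟨ sumTo-single k (m∸n≤m k a) (λ i i≤k i≢k∸a → sumTo-zero n λ j _ →
         term-zero i j (X^Y^-offˣ (n ∸ j) (i≢k∸a⇒k∸i≢a i≤k i≢k∸a))) ⟩
      sumTo n (λ j → f (k ∸ a) j *ℤ (X^ a Y^ b) (k ∸ (k ∸ a)) (n ∸ j))
    ≡⟨ sumTo-single n (m∸n≤m n b) (λ j j≤n j≢n∸b →
         term-zero (k ∸ a) j (X^Y^-offʸ (k ∸ (k ∸ a)) (i≢k∸a⇒k∸i≢a j≤n j≢n∸b))) ⟩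
      f (k ∸ a) (n ∸ b) *ℤ (X^ a Y^ b) (k ∸ (k ∸ a)) (n ∸ (n ∸ b))
    ≡⟨ cong (f (k ∸ a) (n ∸ b) *ℤ_)
            (trans (cong₂ (X^ a Y^ b) (m∸[m∸n]≡n a≤k) (m∸[m∸n]≡n b≤n)) (X^Y^-diag a b)) ⟩
      f (k ∸ a) (n ∸ b) *ℤ 1ℤ
    ≡⟨ ℤ.*-identityʳ _ ⟩
      f (k ∸ a) (n ∸ b)
    ≡⟨ shift-≤ f a≤k b≤n ⟨
      shift a b f k n
    ∎
  by-cases (no a≰k) _ = trans
    (sumTo-zero k λ i _ → sumTo-zero n λ j _ →
      term-zero i j (X^Y^-offˣ (n ∸ j) (<⇒≢ (≤-<-trans (m∸n≤m k i) (≰⇒> a≰k)))))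
    (sym (shift-<ˣ b n f (≰⇒> a≰k)))
  by-cases (yes _) (no b≰n) = trans
    (sumTo-zero k λ i _ → sumTo-zero n λ j _ →
      term-zero i j (X^Y^-offʸ (k ∸ i) (<⇒≢ (≤-<-trans (m∸n≤m n j) (≰⇒> b≰n)))))
    (sym (shift-<ʸ a k f (≰⇒> b≰n)))

⊛-denominator : ∀ f k n → (f ⊛ denominator) k n ≡ f k n +ℤ - shift 2 3 f k n +ℤ - shift 3 5 f k n
⊛-denominator f k n = begin
    (f ⊛ (X^ 0 Y^ 0 ⊖ X^ 2 Y^ 3 ⊖ X^ 3 Y^ 5)) k n
  ≡⟨ ⊛-⊖ f (X^ 0 Y^ 0 ⊖ X^ 2 Y^ 3) (X^ 3 Y^ 5) k n ⟩
    (f ⊛ (X^ 0 Y^ 0 ⊖ X^ 2 Y^ 3)) k n +ℤ - (f ⊛ X^ 3 Y^ 5) k n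
  ≡⟨ cong₂ (λ u v → u +ℤ - v) (⊛-⊖ f (X^ 0 Y^ 0) (X^ 2 Y^ 3) k n) (⊛-X^Y^ f 3 5 k n) ⟩
    (f ⊛ X^ 0 Y^ 0) k n +ℤ - (f ⊛ X^ 2 Y^ 3) k n +ℤ - shift 3 5 f k n
  ≡⟨ cong₂ (λ u v → u +ℤ - v +ℤ - shift 3 5 f k n) (⊛-X^Y^ f 0 0 k n) (⊛-X^Y^ f 2 3 k n) ⟩
    f k n +ℤ - shift 2 3 f k n +ℤ - shift 3 5 f k n
  ∎
  where open ≡-Reasoning

stableSeries : FPS
stableSeries k n = + stableCount 0 k n

stableCount-offset : ∀ a k n → + stableCount a k n ≡ shift a 0 stableSeries k n
stableCount-offset zero    k       n = refl
stableCount-offset (suc a) zero    n =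
  cong +_ (trans (countConfigs-cong {n} λ c → ∧-zeroʳ (evolStableᵇ c)) (countConfigs-none n))
stableCount-offset (suc a) (suc k) n = stableCount-offset a k n

stableSeries-rec : ∀ k m →
  stableSeries k (6 + m) ≡ shift 2 3 stableSeries k (6 + m) +ℤ shift 3 5 stableSeries k (6 + m)
stableSeries-rec k m = begin
    + stableCount 0 k (6 + m)
  ≡⟨ cong +_ (stableCount-rec k m) ⟩
    + (stableCount 2 k (3 + m) + stableCount 3 k (1 + m))
  ≡⟨ ℤ.pos-+ (stableCount 2 k (3 + m)) (stableCount 3 k (1 + m)) ⟩
    + stableCount 2 k (3 + m) +ℤ + stableCount 3 k (1 + m)
  ≡⟨ cong₂ _+ℤ_ (stableCount-offset 2 k (3 + m)) (stableCount-offset 3 k (1 + m)) ⟩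
    shift 2 3 stableSeries k (6 + m) +ℤ shift 3 5 stableSeries k (6 + m)
  ∎
  where open ≡-Reasoning

numerator-vanishes : ∀ k m → numerator k (6 + m) ≡ 0ℤ
numerator-vanishes 0                         m = refl
numerator-vanishes 1                         m = refl
numerator-vanishes 2                         m = refl
numerator-vanishes 3                         m = refl
numerator-vanishes (suc (suc (suc (suc k)))) m = refl

series-identity : ∀ k n →
  stableSeries k n +ℤ - shift 2 3 stableSeries k n +ℤ - shift 3 5 stableSeries k n ≡ numerator k n
series-identity k (suc (suc (suc (suc (suc (suc m)))))) = begin
    stableSeries k (6 + m) +ℤ - A +ℤ - B
  ≡⟨ cong (λ s → s +ℤ - A +ℤ - B) (stableSeries-rec k m) ⟩
    A +ℤ B +ℤ - A +ℤ - B
  ≡⟨ cong (_+ℤ - B) (xyx⁻¹≈y ℤ.+-0-abelianGroup A B) ⟩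
    B +ℤ - B
  ≡⟨ ℤ.+-inverseʳ B ⟩
    0ℤ
  ≡⟨ numerator-vanishes k m ⟨
    numerator k (6 + m)
  ∎
  where
  open ≡-Reasoning
  A B : ℤ
  A = shift 2 3 stableSeries k (6 + m)
  B = shift 3 5 stableSeries k (6 + m)
series-identity 0                               0 = refl
series-identity 1                               0 = refl
series-identity 2                               0 = refl
series-identity 3                               0 = refl
series-identity (suc (suc (suc (suc k))))       0 = refl
series-identity 0                               1 = refl
series-identity 1                               1 = refl
series-identity 2                               1 = refl
series-identity 3                               1 = refl
series-identity (suc (suc (suc (suc k))))       1 = refl
series-identity 0                               2 = refl
series-identity 1                               2 = refl
series-identity 2                               2 = refl
series-identity 3                               2 = refl
series-identity (suc (suc (suc (suc k))))       2 = refl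
series-identity 0                               3 = refl
series-identity 1                               3 = refl
series-identity 2                               3 = refl
series-identity 3                               3 = refl
series-identity (suc (suc (suc (suc k))))       3 = refl
series-identity 0                               4 = refl
series-identity 1                               4 = refl
series-identity 2                               4 = refl
series-identity 3                               4 = refl
series-identity (suc (suc (suc (suc k))))       4 = refl
series-identity 0                               5 = refl
series-identity 1                               5 = refl
series-identity 2                               5 = refl
series-identity 3                               5 = refl
series-identity 4                               5 = refl
series-identity (suc (suc (suc (suc (suc k))))) 5 = refl

mainTheorem5 : ∀ (k n : ℕ) → (JES ⊛ denominator) k n ≡ numerator k n
mainTheorem5 k n = begin
    (JES ⊛ denominator) k n
  ≡⟨ ⊛-congˡ denominator (λ k n → cong +_ (J≡stableCount k n)) k n ⟩
    (stableSeries ⊛ denominator) k n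
  ≡⟨ ⊛-denominator stableSeries k n ⟩
    stableSeries k n +ℤ - shift 2 3 stableSeries k n +ℤ - shift 3 5 stableSeries k n
  ≡⟨ series-identity k n ⟩
    numerator k n
  ∎
  where open ≡-Reasoning
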